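{- Let $a,b\in\mathbb{Z}$ with $a\neq 0$, let $\mathcal{G}(x)=x^8+ax^6+bx^4+ax^2+1$, and set \[W_1=b+2-2a,\qquad W_2=b+2+2a,\qquad W_3=a^2-4b+8.\] \begin{enumerate} \item If there exists a prime $q$ such that $q^2\mid W_1$ or $q^2\mid W_2$, then $\mathcal{G}(x)$ is not monogenic. \item If $W_1$ and $W_2$ are squarefree and there exists a prime $q\ge 3$ such that $q^2\mid W_3$, then $\mathcal{G}(x)$ is not monogenic. \item Suppose that $W_1$ and $W_2$ are squarefree, and that $W_3$ is not divisible by the square of an odd prime. If $(a \bmod 4,\ b\bmod 4)\in\{(0,1),(2,3)\}$, then $\mathcal{G}(x)$ is not monogenic. \end{enumerate}
   Context: A monic polynomial $f(x)\in\mathbb{Z}[x]$ of degree $N$ is called monogenic if $f(x)$ is irreducible over $\mathbb{Q}$ and $\{1,\theta,\dots,\theta^{N-1}\}$ is a basis of the ring of integers of $\mathbb{Q}(\theta)$, where $f(\theta)=0$. -}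

module Defs where

open import Data.Nat as ℕ using (ℕ; zero; suc; _≤_)
open import Data.Nat.Divisibility using (_∣_)
open import Data.Nat.Primality using (Prime)
open import Data.Integer as ℤ using (ℤ; +_; ∣_∣)
open import Data.Integer.DivMod using (_%ℕ_)
open import Data.Rational as ℚ using (ℚ; 0ℚ; 1ℚ)
open import Data.List using (List; []; _∷_; map; _++_; [_])
open import Data.Product using (Σ; _×_)
open import Data.Sum using (_⊎_)
open import Relation.Binary.PropositionalEquality using (_≡_; _≢_)
open import Relation.Nullary using (¬_)

-- Polynomials as coefficient lists, lowest degree first
-- ([c₀, c₁, …, cₙ] represents c₀ + c₁ x + … + cₙ xⁿ).
-- Trailing zeros are allowed; equality is coefficientwise.

QPoly : Set
QPoly = List ℚ

ZPoly : Set
ZPoly = List ℤ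

coeff : QPoly → ℕ → ℚ
coeff []       _       = 0ℚ
coeff (c ∷ cs) zero    = c
coeff (c ∷ cs) (suc n) = coeff cs n

_≃ₚ_ : QPoly → QPoly → Set
p ≃ₚ q = ∀ n → coeff p n ≡ coeff q n

_+ₚ_ : QPoly → QPoly → QPoly
[]       +ₚ q        = q
(a ∷ p)  +ₚ []       = a ∷ p
(a ∷ p)  +ₚ (b ∷ q)  = (a ℚ.+ b) ∷ (p +ₚ q)

-ₚ_ : QPoly → QPoly
-ₚ p = map ℚ.-_ p

_-ₚ_ : QPoly → QPoly → QPoly
p -ₚ q = p +ₚ (-ₚ q)

_*ₚ_ : QPoly → QPoly → QPoly
[]      *ₚ q = []
(a ∷ p) *ₚ q = map (a ℚ.*_) q +ₚ (0ℚ ∷ (p *ₚ q))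

toℚ : ℤ → ℚ
toℚ z = z ℚ./ 1

toQPoly : ZPoly → QPoly
toQPoly = map toℚ

compose : QPoly → QPoly → QPoly
compose []       p = []
compose (c ∷ cs) p = [ c ] +ₚ (p *ₚ compose cs p)

_∣ₚ_ : QPoly → QPoly → Set
f ∣ₚ g = Σ QPoly λ h → g ≃ₚ (h *ₚ f)

IsConstant : QPoly → Set
IsConstant p = ∀ n → 1 ≤ n → coeff p n ≡ 0ℚ

-- irreducibility over ℚ of a polynomial in ℤ[x]:
-- nonconstant, and every factorisation in ℚ[x] has a constant factor
-- (constant factors of a nonzero polynomial are units of ℚ[x]).
IrreducibleOverℚ : ZPoly → Set
IrreducibleOverℚ f =
  ¬ IsConstant (toQPoly f) ×
  (∀ g h → toQPoly f ≃ₚ (g *ₚ h) → IsConstant g ⊎ IsConstant h)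

monicFrom : List ℤ → ZPoly
monicFrom cs = cs ++ [ + 1 ]

-- Elements of K = ℚ(θ) ≅ ℚ[x]/(f), θ = class of x, are represented by
-- polynomials p ∈ ℚ[x] (the element p(θ)).  Two representatives denote the
-- same element iff f divides their difference.
IsIntegralElem : ZPoly → QPoly → Set
IsIntegralElem f p =
  Σ (List ℤ) λ cs → toQPoly f ∣ₚ compose (toQPoly (monicFrom cs)) p

InZθ : ZPoly → QPoly → Set
InZθ f p = Σ ZPoly λ r → toQPoly f ∣ₚ (p -ₚ toQPoly r)

-- f monogenic: f irreducible over ℚ and {1, θ, …, θ^{N-1}} is a ℤ-basis of
-- the ring of integers O_K.  These powers always lie in O_K and are
-- ℚ-linearly independent (f irreducible, monic of degree N), so the basis
-- condition says exactly that every algebraic integer of K lies in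
-- their ℤ-span ℤ[θ].
Monogenic : ZPoly → Set
Monogenic f = IrreducibleOverℚ f × (∀ p → IsIntegralElem f p → InZθ f p)

𝒢 : ℤ → ℤ → ZPoly
𝒢 a b = + 1 ∷ + 0 ∷ a ∷ + 0 ∷ b ∷ + 0 ∷ a ∷ + 0 ∷ + 1 ∷ []

W₁ W₂ W₃ : ℤ → ℤ → ℤ
W₁ a b = b ℤ.+ + 2 ℤ.- + 2 ℤ.* a
W₂ a b = b ℤ.+ + 2 ℤ.+ + 2 ℤ.* a
W₃ a b = a ℤ.* a ℤ.- + 4 ℤ.* b ℤ.+ + 8

-- squarefree integer: no square d² > 1 divides it (so 0 is not squarefree)
Squarefree : ℤ → Set
Squarefree w = ∀ d → d ℕ.* d ∣ ∣ w ∣ → d ≡ 1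

SqDivides : ℕ → ℤ → Set
SqDivides q w = q ℕ.* q ∣ ∣ w ∣

-- With u = θ² + θ⁻², the palindromic equation 𝒢(θ) = 0 reads θ⁴ h(u) = 0 for
-- h(u) = u² + a u + b − 2, so h(u) = 0, and W₁ = h(−2), W₂ = h(2), W₃ = a² − 4(b − 2)
-- is the discriminant of h.  Each hypothesis produces an algebraic integer of ℚ(θ)
-- outside ℤ[θ]:
--   * if W₁ = m q² (resp. W₂ = m q²), then v = θ + θ⁻¹ (resp. θ − θ⁻¹) satisfies
--     v⁴ + (a ∓ 4) v² + W = 0, so α = W/(q v) is a root of y⁴ + m (a ∓ 4) y² + m² W;
--   * if W₃ = m q² with q odd, then (2u + a)/q is a root of y² − m;
--   * if a = 4s, b = 1 + 4t (resp. a = 2 + 4s, b = 3 + 4t), then (u + 2s + 1)/2 is a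
--     root of y² − y + t − s² (resp. y² + t − s − s²).
-- Each of these elements has a θⁱ-coordinate 1/q, −2/q or −1/2 in the basis
-- 1, θ, …, θ⁷.  Coordinates are read off by pairing coefficient lists with integer
-- sequences that satisfy the linear recurrence of 𝒢; such pairings vanish on the
-- ideal (𝒢) and are integral on ℤ[x], so an element of ℤ[θ] has integral coordinates.

module Submission where

open import Defs
open import Data.Nat as ℕ using (ℕ; zero; suc; _≤_; s≤s; z≤n; nonTrivial⇒n>1)
import Data.Nat.Properties as ℕP
import Data.Nat.Coprimality as Coprimality
open import Data.Nat.Divisibility as ℕ∣ using (divides)
open import Data.Nat.Primality using (Prime; prime⇒nonTrivial)
open import Data.Integer as ℤ using (ℤ; +_; -[1+_])
import Data.Integer.Properties as ℤP
open import Data.Integer.DivMod using (_%ℕ_; _/ℕ_; a≡a%ℕn+[a/ℕn]*n)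
open import Data.Rational as ℚ using (ℚ; 0ℚ; 1ℚ; mkℚ)
import Data.Rational.Properties as ℚP
open import Data.List using ([]; _∷_; map; [_])
open import Data.List.Relation.Unary.All using (All; []; _∷_; all?)
import Data.Maybe as Maybe
open import Data.Bool using (if_then_else_)
open import Data.Product using (Σ; _×_; _,_; proj₁; proj₂)
open import Data.Sum using (_⊎_; inj₁; inj₂)
open import Function using (_∘_)
open import Algebra.Bundles using (CommutativeRing)
open import Algebra.Structures using (IsCommutativeRing)
open import Relation.Binary.Bundles using (Setoid)
import Relation.Binary.Reasoning.Setoid as SetoidReasoning
open import Relation.Binary.PropositionalEquality
  using (_≡_; _≢_; refl; sym; trans; cong; cong₂; module ≡-Reasoning)
open import Relation.Nullary using (¬_)
open import Relation.Nullary.Decidable using (dec⇒maybe)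
open import Tactic.RingSolver using (solve-∀)
open import Tactic.RingSolver.Core.AlmostCommutativeRing
  using (AlmostCommutativeRing; fromCommutativeRing)

ℚ-ring : AlmostCommutativeRing _ _
ℚ-ring = fromCommutativeRing ℚP.+-*-commutativeRing (λ x → dec⇒maybe (0ℚ ℚ.≟ x))

toℚ≡mkℚ : ∀ z → toℚ z ≡ mkℚ z 0 (Coprimality.sym (Coprimality.1-coprimeTo ℤ.∣ z ∣))
toℚ≡mkℚ z = ℚP.↥p/↧p≡p _

-- Once both summands are in normal form, their ℚ-sum computes to (x·1 + y·1)/1.
toℚ-homo-+ : ∀ x y → toℚ (x ℤ.+ y) ≡ toℚ x ℚ.+ toℚ y
toℚ-homo-+ x y rewrite toℚ≡mkℚ x | toℚ≡mkℚ y =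
  cong₂ (λ u v → toℚ (u ℤ.+ v)) (sym (ℤP.*-identityʳ x)) (sym (ℤP.*-identityʳ y))

toℚ-homo-* : ∀ x y → toℚ (x ℤ.* y) ≡ toℚ x ℚ.* toℚ y
toℚ-homo-* x y rewrite toℚ≡mkℚ x | toℚ≡mkℚ y = refl

toℚ-homo‿- : ∀ x → toℚ (ℤ.- x) ≡ ℚ.- toℚ x
toℚ-homo‿- x rewrite toℚ≡mkℚ (ℤ.- x) | toℚ≡mkℚ x with x
... | + zero   = refl
... | + suc n  = refl
... | -[1+ n ] = refl

toℚ-injective : ∀ {x y} → toℚ x ≡ toℚ y → x ≡ y
toℚ-injective {x} {y} eq rewrite toℚ≡mkℚ x | toℚ≡mkℚ y = cong ℚ.numerator eq

-- The polynomial ring ℚ[x]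

_·ₚ_ : ℚ → QPoly → QPoly
c ·ₚ p = map (c ℚ.*_) p

X : QPoly
X = 0ℚ ∷ 1ℚ ∷ []

infix 4 _≋_
record _≋_ (p q : QPoly) : Set where
  constructor coeffwise
  field ≋⇒≃ₚ : p ≃ₚ q
open _≋_

≋-refl : ∀ {p} → p ≋ p
≋-refl = coeffwise λ _ → refl

≋-sym : ∀ {p q} → p ≋ q → q ≋ p
≋-sym (coeffwise e) = coeffwise λ n → sym (e n)

≋-trans : ∀ {p q r} → p ≋ q → q ≋ r → p ≋ r
≋-trans (coeffwise e) (coeffwise e′) = coeffwise λ n → trans (e n) (e′ n)

≋-setoid : Setoid _ _
≋-setoid = record
  { Carrier = QPoly ; _≈_ = _≋_
  ; isEquivalence = record { refl = ≋-refl ; sym = ≋-sym ; trans = ≋-trans } }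

∷-cong : ∀ {a b p q} → a ≡ b → p ≋ q → a ∷ p ≋ b ∷ q
∷-cong e (coeffwise e′) = coeffwise λ { zero → e ; (suc n) → e′ n }

∷-zero : ∀ {a p} → a ≡ 0ℚ → p ≋ [] → a ∷ p ≋ []
∷-zero e (coeffwise e′) = coeffwise λ { zero → e ; (suc n) → e′ n }

∷-tail : ∀ {a b p q} → a ∷ p ≋ b ∷ q → p ≋ q
∷-tail (coeffwise e) = coeffwise (e ∘ suc)

all-zero : ∀ {p} → All (_≡ 0ℚ) p → p ≋ []
all-zero []       = ≋-refl
all-zero (e ∷ es) = ∷-zero e (all-zero es)

coeff-+ₚ : ∀ p q n → coeff (p +ₚ q) n ≡ coeff p n ℚ.+ coeff q n
coeff-+ₚ []      q       n       = sym (ℚP.+-identityˡ _)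
coeff-+ₚ (a ∷ p) []      n       = sym (ℚP.+-identityʳ _)
coeff-+ₚ (a ∷ p) (b ∷ q) zero    = refl
coeff-+ₚ (a ∷ p) (b ∷ q) (suc n) = coeff-+ₚ p q n

coeff-map : ∀ {g} → g 0ℚ ≡ 0ℚ → ∀ p n → coeff (map g p) n ≡ g (coeff p n)
coeff-map g0 []      n       = sym g0
coeff-map g0 (a ∷ p) zero    = refl
coeff-map g0 (a ∷ p) (suc n) = coeff-map g0 p n

+ₚ-cong : ∀ {p p′ q q′} → p ≋ p′ → q ≋ q′ → p +ₚ q ≋ p′ +ₚ q′
+ₚ-cong {p} {p′} {q} {q′} (coeffwise e) (coeffwise e′) = coeffwise λ n → begin
  coeff (p +ₚ q) n          ≡⟨ coeff-+ₚ p q n ⟩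
  coeff p n ℚ.+ coeff q n   ≡⟨ cong₂ ℚ._+_ (e n) (e′ n) ⟩
  coeff p′ n ℚ.+ coeff q′ n ≡⟨ coeff-+ₚ p′ q′ n ⟨
  coeff (p′ +ₚ q′) n        ∎
  where open ≡-Reasoning

-ₚ-cong : ∀ {p q} → p ≋ q → -ₚ p ≋ -ₚ q
-ₚ-cong {p} {q} (coeffwise e) = coeffwise λ n →
  trans (coeff-map refl p n) (trans (cong ℚ.-_ (e n)) (sym (coeff-map refl q n)))

·ₚ-congʳ : ∀ c {p q} → p ≋ q → c ·ₚ p ≋ c ·ₚ q
·ₚ-congʳ c {p} {q} (coeffwise e) = coeffwise λ n →
  trans (coeff-map (ℚP.*-zeroʳ c) p n)
        (trans (cong (c ℚ.*_) (e n)) (sym (coeff-map (ℚP.*-zeroʳ c) q n)))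

+ₚ-assoc : ∀ p q r → (p +ₚ q) +ₚ r ≋ p +ₚ (q +ₚ r)
+ₚ-assoc []      q       r       = ≋-refl
+ₚ-assoc (a ∷ p) []      r       = ≋-refl
+ₚ-assoc (a ∷ p) (b ∷ q) []      = ≋-refl
+ₚ-assoc (a ∷ p) (b ∷ q) (c ∷ r) = ∷-cong (ℚP.+-assoc a b c) (+ₚ-assoc p q r)

+ₚ-comm : ∀ p q → p +ₚ q ≋ q +ₚ p
+ₚ-comm []      []      = ≋-refl
+ₚ-comm []      (b ∷ q) = ≋-refl
+ₚ-comm (a ∷ p) []      = ≋-refl
+ₚ-comm (a ∷ p) (b ∷ q) = ∷-cong (ℚP.+-comm a b) (+ₚ-comm p q)

+ₚ-identityʳ : ∀ p → p +ₚ [] ≋ p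
+ₚ-identityʳ []      = ≋-refl
+ₚ-identityʳ (a ∷ p) = ≋-refl

-ₚ-inverseˡ : ∀ p → (-ₚ p) +ₚ p ≋ []
-ₚ-inverseˡ []      = ≋-refl
-ₚ-inverseˡ (a ∷ p) = ∷-zero (ℚP.+-inverseˡ a) (-ₚ-inverseˡ p)

+ₚ-leftComm : ∀ p q r → p +ₚ (q +ₚ r) ≋ q +ₚ (p +ₚ r)
+ₚ-leftComm p q r = begin
  p +ₚ (q +ₚ r) ≈⟨ +ₚ-assoc p q r ⟨
  (p +ₚ q) +ₚ r ≈⟨ +ₚ-cong (+ₚ-comm p q) ≋-refl ⟩
  (q +ₚ p) +ₚ r ≈⟨ +ₚ-assoc q p r ⟩
  q +ₚ (p +ₚ r) ∎
  where open SetoidReasoning ≋-setoid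

+ₚ-interchange : ∀ p q r s → (p +ₚ q) +ₚ (r +ₚ s) ≋ (p +ₚ r) +ₚ (q +ₚ s)
+ₚ-interchange p q r s = begin
  (p +ₚ q) +ₚ (r +ₚ s) ≈⟨ +ₚ-assoc p q (r +ₚ s) ⟩
  p +ₚ (q +ₚ (r +ₚ s)) ≈⟨ +ₚ-cong (≋-refl {p}) (+ₚ-leftComm q r s) ⟩
  p +ₚ (r +ₚ (q +ₚ s)) ≈⟨ +ₚ-assoc p r (q +ₚ s) ⟨
  (p +ₚ r) +ₚ (q +ₚ s) ∎
  where open SetoidReasoning ≋-setoid

·ₚ-distribˡ : ∀ c p q → c ·ₚ (p +ₚ q) ≋ (c ·ₚ p) +ₚ (c ·ₚ q)
·ₚ-distribˡ c []      q       = ≋-refl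
·ₚ-distribˡ c (a ∷ p) []      = ≋-refl
·ₚ-distribˡ c (a ∷ p) (b ∷ q) = ∷-cong (ℚP.*-distribˡ-+ c a b) (·ₚ-distribˡ c p q)

·ₚ-distribʳ : ∀ c d p → (c ℚ.+ d) ·ₚ p ≋ (c ·ₚ p) +ₚ (d ·ₚ p)
·ₚ-distribʳ c d []      = ≋-refl
·ₚ-distribʳ c d (a ∷ p) = ∷-cong (ℚP.*-distribʳ-+ a c d) (·ₚ-distribʳ c d p)

·ₚ-assoc : ∀ c d p → c ·ₚ (d ·ₚ p) ≋ (c ℚ.* d) ·ₚ p
·ₚ-assoc c d []      = ≋-refl
·ₚ-assoc c d (a ∷ p) = ∷-cong (sym (ℚP.*-assoc c d a)) (·ₚ-assoc c d p)

·ₚ-zeroˡ : ∀ p → 0ℚ ·ₚ p ≋ []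
·ₚ-zeroˡ []      = ≋-refl
·ₚ-zeroˡ (a ∷ p) = ∷-zero (ℚP.*-zeroˡ a) (·ₚ-zeroˡ p)

·ₚ-identityˡ : ∀ p → 1ℚ ·ₚ p ≋ p
·ₚ-identityˡ []      = ≋-refl
·ₚ-identityˡ (a ∷ p) = ∷-cong (ℚP.*-identityˡ a) (·ₚ-identityˡ p)

shift-*ₚ : ∀ p q → (0ℚ ∷ p) *ₚ q ≋ 0ℚ ∷ (p *ₚ q)
shift-*ₚ p q = +ₚ-cong (·ₚ-zeroˡ q) ≋-refl

*ₚ-zeroʳ : ∀ p → p *ₚ [] ≋ []
*ₚ-zeroʳ []      = ≋-refl
*ₚ-zeroʳ (a ∷ p) = ∷-zero refl (*ₚ-zeroʳ p)

*ₚ-vanishˡ : ∀ {p} q → p ≋ [] → p *ₚ q ≋ []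
*ₚ-vanishˡ {[]}    q e              = ≋-refl
*ₚ-vanishˡ {a ∷ p} q (coeffwise e₀) =
  +ₚ-cong (≋-trans (·ₚ-congˡ (e₀ 0)) (·ₚ-zeroˡ q))
          (∷-zero refl (*ₚ-vanishˡ {p} q (coeffwise (e₀ ∘ suc))))
  where
  ·ₚ-congˡ : ∀ {c d} → c ≡ d → c ·ₚ q ≋ d ·ₚ q
  ·ₚ-congˡ refl = ≋-refl

*ₚ-congˡ : ∀ {p p′} q → p ≋ p′ → p *ₚ q ≋ p′ *ₚ q
*ₚ-congˡ {[]}    {p′}     q e = ≋-sym (*ₚ-vanishˡ q (≋-sym e))
*ₚ-congˡ {a ∷ p} {[]}     q e = *ₚ-vanishˡ q e
*ₚ-congˡ {a ∷ p} {b ∷ p′} q e@(coeffwise e₀) with e₀ 0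
... | refl = +ₚ-cong ≋-refl (∷-cong refl (*ₚ-congˡ q (∷-tail e)))

*ₚ-congʳ : ∀ p {q q′} → q ≋ q′ → p *ₚ q ≋ p *ₚ q′
*ₚ-congʳ []      e = ≋-refl
*ₚ-congʳ (a ∷ p) e = +ₚ-cong (·ₚ-congʳ a e) (∷-cong refl (*ₚ-congʳ p e))

*ₚ-∷ʳ : ∀ p b q → p *ₚ (b ∷ q) ≋ (b ·ₚ p) +ₚ (0ℚ ∷ (p *ₚ q))
*ₚ-∷ʳ []      b q = ≋-sym (∷-zero refl ≋-refl)
*ₚ-∷ʳ (a ∷ p) b q =
  ∷-cong (cong (ℚ._+ 0ℚ) (ℚP.*-comm a b))
    (≋-trans (+ₚ-cong ≋-refl (*ₚ-∷ʳ p b q)) (+ₚ-leftComm (a ·ₚ q) (b ·ₚ p) _))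

*ₚ-comm : ∀ p q → p *ₚ q ≋ q *ₚ p
*ₚ-comm []      q = ≋-sym (*ₚ-zeroʳ q)
*ₚ-comm (a ∷ p) q =
  ≋-trans (+ₚ-cong ≋-refl (∷-cong refl (*ₚ-comm p q))) (≋-sym (*ₚ-∷ʳ q a p))

·ₚ-*ₚ : ∀ c p q → (c ·ₚ p) *ₚ q ≋ c ·ₚ (p *ₚ q)
·ₚ-*ₚ c []      q = ≋-refl
·ₚ-*ₚ c (a ∷ p) q =
  ≋-trans (+ₚ-cong (≋-sym (·ₚ-assoc c a q)) (∷-cong (sym (ℚP.*-zeroʳ c)) (·ₚ-*ₚ c p q)))
          (≋-sym (·ₚ-distribˡ c (a ·ₚ q) (0ℚ ∷ (p *ₚ q))))

*ₚ-distribʳ : ∀ p p′ q → (p +ₚ p′) *ₚ q ≋ (p *ₚ q) +ₚ (p′ *ₚ q)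
*ₚ-distribʳ []      p′       q = ≋-refl
*ₚ-distribʳ (a ∷ p) []       q = ≋-sym (+ₚ-identityʳ _)
*ₚ-distribʳ (a ∷ p) (b ∷ p′) q =
  ≋-trans (+ₚ-cong (·ₚ-distribʳ a b q) (∷-cong (sym (ℚP.+-identityˡ 0ℚ)) (*ₚ-distribʳ p p′ q)))
          (+ₚ-interchange (a ·ₚ q) (b ·ₚ q) (0ℚ ∷ (p *ₚ q)) (0ℚ ∷ (p′ *ₚ q)))

*ₚ-distribˡ : ∀ p q r → p *ₚ (q +ₚ r) ≋ (p *ₚ q) +ₚ (p *ₚ r)
*ₚ-distribˡ p q r =
  ≋-trans (*ₚ-comm p (q +ₚ r)) (≋-trans (*ₚ-distribʳ q r p) (+ₚ-cong (*ₚ-comm q p) (*ₚ-comm r p)))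

*ₚ-assoc : ∀ p q r → (p *ₚ q) *ₚ r ≋ p *ₚ (q *ₚ r)
*ₚ-assoc []      q r = ≋-refl
*ₚ-assoc (a ∷ p) q r =
  ≋-trans (*ₚ-distribʳ (a ·ₚ q) (0ℚ ∷ (p *ₚ q)) r)
    (+ₚ-cong (·ₚ-*ₚ a q r) (≋-trans (shift-*ₚ (p *ₚ q) r) (∷-cong refl (*ₚ-assoc p q r))))

*ₚ-identityˡ : ∀ p → [ 1ℚ ] *ₚ p ≋ p
*ₚ-identityˡ p = ≋-trans (+ₚ-cong (·ₚ-identityˡ p) (∷-zero refl ≋-refl)) (+ₚ-identityʳ p)

ℚ[x]-isCommutativeRing : IsCommutativeRing _≋_ _+ₚ_ _*ₚ_ -ₚ_ [] [ 1ℚ ]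
ℚ[x]-isCommutativeRing = record
  { isRing = record
    { +-isAbelianGroup = record
      { isGroup = record
        { isMonoid = record
          { isSemigroup = record
            { isMagma = record
              { isEquivalence = record { refl = ≋-refl ; sym = ≋-sym ; trans = ≋-trans }
              ; ∙-cong = +ₚ-cong }
            ; assoc = +ₚ-assoc }
          ; identity = (λ p → ≋-refl) , +ₚ-identityʳ }
        ; inverse = -ₚ-inverseˡ , (λ p → ≋-trans (+ₚ-comm p (-ₚ p)) (-ₚ-inverseˡ p))
        ; ⁻¹-cong = -ₚ-cong }
      ; comm = +ₚ-comm }
    ; *-cong = λ {p} {p′} {q} {q′} e e′ → ≋-trans (*ₚ-congˡ q e) (*ₚ-congʳ p′ e′)
    ; *-assoc = *ₚ-assoc
    ; *-identity = *ₚ-identityˡ , (λ p → ≋-trans (*ₚ-comm p [ 1ℚ ]) (*ₚ-identityˡ p))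
    ; distrib = *ₚ-distribˡ , (λ p q r → *ₚ-distribʳ q r p) }
  ; *-comm = *ₚ-comm }

-- The solver's coefficients are closed polynomials, whose vanishing is decided coefficientwise.
ℚ[x] : AlmostCommutativeRing _ _
ℚ[x] = fromCommutativeRing (record { isCommutativeRing = ℚ[x]-isCommutativeRing }) λ p →
  Maybe.map (λ zeros → ≋-sym (all-zero zeros)) (dec⇒maybe (all? (ℚ._≟ 0ℚ) p))

-ₚ‿*ₚ : ∀ p q → -ₚ (p *ₚ q) ≋ (-ₚ p) *ₚ q
-ₚ‿*ₚ = solve-∀ ℚ[x]

horner : ∀ cs → cs ≋ compose cs X
horner []       = ≋-refl
horner (c ∷ cs) = ≋-sym (begin
  [ c ] +ₚ (X *ₚ compose cs X)
    ≈⟨ +ₚ-cong {p = [ c ]} ≋-refl (shift-*ₚ [ 1ℚ ] (compose cs X)) ⟩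
  [ c ] +ₚ (0ℚ ∷ ([ 1ℚ ] *ₚ compose cs X))
    ≈⟨ ∷-cong (ℚP.+-identityʳ c) (*ₚ-identityˡ _) ⟩
  c ∷ compose cs X
    ≈⟨ ∷-cong refl (horner cs) ⟨
  c ∷ cs ∎)
  where open SetoidReasoning ≋-setoid

[]-homo-* : ∀ c d → [ c ℚ.* d ] ≋ [ c ] *ₚ [ d ]
[]-homo-* c d = ∷-cong (sym (ℚP.+-identityʳ (c ℚ.* d))) ≋-refl

-- Representatives of degree < 8, with A, B standing for a, b: for
-- H(t) = t⁴ + A t³ + B t² + A t + 1, W₁-numerator is θ (H(θ²) − W₁)/(θ² + 1), which is
-- −W₁/(θ + θ⁻¹) modulo 𝒢, and W₂-numerator is θ (H(θ²) − W₂)/(θ² − 1) ≡ −W₂/(θ − θ⁻¹).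
W₁-numerator W₂-numerator x²+x⁻²-coeffs : ℚ → ℚ → QPoly
W₁-numerator A B =
  0ℚ ∷ A ℚ.+ A ℚ.- B ℚ.- 1ℚ ∷ 0ℚ ∷ B ℚ.- A ℚ.+ 1ℚ ∷ 0ℚ ∷ A ℚ.- 1ℚ ∷ 0ℚ ∷ 1ℚ ∷ []
W₂-numerator A B =
  0ℚ ∷ B ℚ.+ A ℚ.+ A ℚ.+ 1ℚ ∷ 0ℚ ∷ B ℚ.+ A ℚ.+ 1ℚ ∷ 0ℚ ∷ A ℚ.+ 1ℚ ∷ 0ℚ ∷ 1ℚ ∷ []
x²+x⁻²-coeffs A B = ℚ.- A ∷ 0ℚ ∷ 1ℚ ℚ.- B ∷ 0ℚ ∷ ℚ.- A ∷ 0ℚ ∷ ℚ.- 1ℚ ∷ []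

-- The quotient ring ℚ[x]/(f)

module Quotient (f : QPoly) where

  -- Congruence modulo f, as a record so that unification never unfolds it.
  infix 4 _≈_
  infix 0 _by_
  record _≈_ (p q : QPoly) : Set where
    constructor _by_
    field
      quotient   : QPoly
      difference : p -ₚ q ≋ quotient *ₚ f

  -- Proved by hand rather than by the solver: the zero test of `ring` below evaluates it.
  ≋⇒≈ : ∀ {p q} → p ≋ q → p ≈ q
  ≋⇒≈ {p} {q} (coeffwise e) = [] by coeffwise λ n →
    trans (coeff-+ₚ p (-ₚ q) n)
          (trans (cong₂ ℚ._+_ (e n) (coeff-map refl q n)) (ℚP.+-inverseʳ (coeff q n)))

  ≈-refl : ∀ {p} → p ≈ p
  ≈-refl = ≋⇒≈ ≋-refl

  ≈-sym : ∀ {p q} → p ≈ q → q ≈ p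
  ≈-sym {p} {q} (h by e) = -ₚ h by begin
    q -ₚ p       ≈⟨ negate p q ⟩
    -ₚ (p -ₚ q)  ≈⟨ -ₚ-cong e ⟩
    -ₚ (h *ₚ f)  ≈⟨ -ₚ‿*ₚ h f ⟩
    (-ₚ h) *ₚ f  ∎
    where
    open SetoidReasoning ≋-setoid
    negate : ∀ p q → q -ₚ p ≋ -ₚ (p -ₚ q)
    negate = solve-∀ ℚ[x]

  ≈-trans : ∀ {p q r} → p ≈ q → q ≈ r → p ≈ r
  ≈-trans {p} {q} {r} (h by e) (h′ by e′) = h +ₚ h′ by begin
    p -ₚ r                 ≈⟨ telescope p q r ⟩
    (p -ₚ q) +ₚ (q -ₚ r)   ≈⟨ +ₚ-cong e e′ ⟩
    (h *ₚ f) +ₚ (h′ *ₚ f)  ≈⟨ *ₚ-distribʳ h h′ f ⟨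
    (h +ₚ h′) *ₚ f         ∎
    where
    open SetoidReasoning ≋-setoid
    telescope : ∀ p q r → p -ₚ r ≋ (p -ₚ q) +ₚ (q -ₚ r)
    telescope = solve-∀ ℚ[x]

  +-cong : ∀ {p p′ q q′} → p ≈ p′ → q ≈ q′ → p +ₚ q ≈ p′ +ₚ q′
  +-cong {p} {p′} {q} {q′} (h by e) (h′ by e′) = h +ₚ h′ by begin
    (p +ₚ q) -ₚ (p′ +ₚ q′)  ≈⟨ regroup p q p′ q′ ⟩
    (p -ₚ p′) +ₚ (q -ₚ q′)  ≈⟨ +ₚ-cong e e′ ⟩
    (h *ₚ f) +ₚ (h′ *ₚ f)   ≈⟨ *ₚ-distribʳ h h′ f ⟨
    (h +ₚ h′) *ₚ f          ∎
    where
    open SetoidReasoning ≋-setoid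
    regroup : ∀ p q p′ q′ → (p +ₚ q) -ₚ (p′ +ₚ q′) ≋ (p -ₚ p′) +ₚ (q -ₚ q′)
    regroup = solve-∀ ℚ[x]

  *-congˡ : ∀ p {q q′} → q ≈ q′ → p *ₚ q ≈ p *ₚ q′
  *-congˡ p {q} {q′} (h by e) = p *ₚ h by begin
    (p *ₚ q) -ₚ (p *ₚ q′)  ≈⟨ factor p q q′ ⟩
    p *ₚ (q -ₚ q′)         ≈⟨ *ₚ-congʳ p e ⟩
    p *ₚ (h *ₚ f)          ≈⟨ *ₚ-assoc p h f ⟨
    (p *ₚ h) *ₚ f          ∎
    where
    open SetoidReasoning ≋-setoid
    factor : ∀ p q q′ → (p *ₚ q) -ₚ (p *ₚ q′) ≋ p *ₚ (q -ₚ q′)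
    factor = solve-∀ ℚ[x]

  *-cong : ∀ {p p′ q q′} → p ≈ p′ → q ≈ q′ → p *ₚ q ≈ p′ *ₚ q′
  *-cong {p} {p′} {q} {q′} e e′ =
    ≈-trans (*-congˡ p e′) (≈-trans (≋⇒≈ (*ₚ-comm p q′))
      (≈-trans (*-congˡ q′ e) (≋⇒≈ (*ₚ-comm q′ p′))))

  -‿cong : ∀ {p q} → p ≈ q → -ₚ p ≈ -ₚ q
  -‿cong {p} {q} (h by e) = -ₚ h by begin
    (-ₚ p) -ₚ (-ₚ q)  ≈⟨ negate p q ⟩
    -ₚ (p -ₚ q)       ≈⟨ -ₚ-cong e ⟩
    -ₚ (h *ₚ f)       ≈⟨ -ₚ‿*ₚ h f ⟩
    (-ₚ h) *ₚ f       ∎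
    where
    open SetoidReasoning ≋-setoid
    negate : ∀ p q → (-ₚ p) -ₚ (-ₚ q) ≋ -ₚ (p -ₚ q)
    negate = solve-∀ ℚ[x]

  isCommutativeRing : IsCommutativeRing _≈_ _+ₚ_ _*ₚ_ -ₚ_ [] [ 1ℚ ]
  isCommutativeRing = record
    { isRing = record
      { +-isAbelianGroup = record
        { isGroup = record
          { isMonoid = record
            { isSemigroup = record
              { isMagma = record
                { isEquivalence = record { refl = ≈-refl ; sym = ≈-sym ; trans = ≈-trans }
                ; ∙-cong = +-cong }
              ; assoc = λ p q r → ≋⇒≈ (+-assoc p q r) }
            ; identity = (λ p → ≋⇒≈ (+-identityˡ p)) , (λ p → ≋⇒≈ (+-identityʳ p)) }
          ; inverse = (λ p → ≋⇒≈ (-‿inverseˡ p)) , (λ p → ≋⇒≈ (-‿inverseʳ p))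
          ; ⁻¹-cong = -‿cong }
        ; comm = λ p q → ≋⇒≈ (+-comm p q) }
      ; *-cong = *-cong
      ; *-assoc = λ p q r → ≋⇒≈ (*-assoc p q r)
      ; *-identity = (λ p → ≋⇒≈ (*-identityˡ p)) , (λ p → ≋⇒≈ (*-identityʳ p))
      ; distrib = (λ p q r → ≋⇒≈ (distribˡ p q r)) , (λ p q r → ≋⇒≈ (distribʳ p q r)) }
    ; *-comm = λ p q → ≋⇒≈ (*-comm p q) }
    where
    open IsCommutativeRing ℚ[x]-isCommutativeRing
      using ( +-assoc; +-identityˡ; +-identityʳ; -‿inverseˡ; -‿inverseʳ; +-comm
            ; *-assoc; *-identityˡ; *-identityʳ; distribˡ; distribʳ; *-comm)

  commutativeRing : CommutativeRing _ _
  commutativeRing = record { isCommutativeRing = isCommutativeRing }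

  ring : AlmostCommutativeRing _ _
  ring = fromCommutativeRing commutativeRing λ p →
    Maybe.map (λ zeros → ≋⇒≈ (≋-sym (all-zero zeros))) (dec⇒maybe (all? (ℚ._≟ 0ℚ) p))

  open AlmostCommutativeRing ring public using (_+_; _*_; -_; _^_; 0#; 1#; setoid)
  open import Algebra.Properties.Semiring.Exp.TCOptimised (AlmostCommutativeRing.semiring ring)
    using (^-congˡ)
  open SetoidReasoning setoid

  f≈0 : f ≈ 0#
  f≈0 = [ 1ℚ ] by ≋-trans (+ₚ-identityʳ f) (≋-sym (*ₚ-identityˡ f))

  ≈0⇒∣ₚ : ∀ {p} → p ≈ 0# → f ∣ₚ p
  ≈0⇒∣ₚ {p} (h by e) = h , ≋⇒≃ₚ (≋-trans (≋-sym (+ₚ-identityʳ p)) e)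

  ≡⇒≈ : ∀ {p q} → p ≡ q → p ≈ q
  ≡⇒≈ refl = ≈-refl

  2# 3# 4# 8# ½# : QPoly
  2# = [ toℚ (+ 2) ]
  3# = [ toℚ (+ 3) ]
  4# = [ toℚ (+ 4) ]
  8# = [ toℚ (+ 8) ]
  ½# = [ ℚ.½ ]

  ⟦_⟧ : ℤ → QPoly
  ⟦ z ⟧ = [ toℚ z ]

  ⟦⟧-homo-+ : ∀ x y → ⟦ x ℤ.+ y ⟧ ≈ ⟦ x ⟧ + ⟦ y ⟧
  ⟦⟧-homo-+ x y = ≡⇒≈ (cong [_] (toℚ-homo-+ x y))

  ⟦⟧-homo-* : ∀ x y → ⟦ x ℤ.* y ⟧ ≈ ⟦ x ⟧ * ⟦ y ⟧
  ⟦⟧-homo-* x y = ≈-trans (≡⇒≈ (cong [_] (toℚ-homo-* x y))) (≋⇒≈ ([]-homo-* (toℚ x) (toℚ y)))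

  ⟦⟧-homo‿- : ∀ x → ⟦ ℤ.- x ⟧ ≈ - ⟦ x ⟧
  ⟦⟧-homo‿- x = ≡⇒≈ (cong [_] (toℚ-homo‿- x))

  vanishes₁ : ∀ {e z} c → e ≈ c * z → z ≈ 0# → e ≈ 0#
  vanishes₁ {e} {z} c e≈cz z≈0 = begin
    e       ≈⟨ e≈cz ⟩
    c * z   ≈⟨ *-congˡ c z≈0 ⟩
    c * 0#  ≈⟨ ≋⇒≈ (*ₚ-zeroʳ c) ⟩
    0#      ∎

  vanishes₂ : ∀ {e z₁ z₂} c₁ c₂ → e ≈ c₁ * z₁ + c₂ * z₂ → z₁ ≈ 0# → z₂ ≈ 0# → e ≈ 0#
  vanishes₂ {e} {z₁} {z₂} c₁ c₂ e≈ z₁≈0 z₂≈0 = begin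
    e                  ≈⟨ e≈ ⟩
    c₁ * z₁ + c₂ * z₂  ≈⟨ +-cong (vanishes₁ c₁ ≈-refl z₁≈0) (vanishes₁ c₂ ≈-refl z₂≈0) ⟩
    0#                 ∎

  monic-root² : ∀ {y} c₀ c₁ → y ^ 2 + ⟦ c₁ ⟧ * y + ⟦ c₀ ⟧ ≈ 0# →
                compose (toQPoly (monicFrom (c₀ ∷ c₁ ∷ []))) y ≈ 0#
  monic-root² {y} c₀ c₁ = ≈-trans (horner-form ⟦ c₀ ⟧ ⟦ c₁ ⟧ y)
    where
    horner-form : ∀ C₀ C₁ y → C₀ + y * (C₁ + y * (1# + y * 0#)) ≈ y ^ 2 + C₁ * y + C₀
    horner-form = solve-∀ ring

  monic-root₀² : ∀ {y} c₀ → y ^ 2 + ⟦ c₀ ⟧ ≈ 0# →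
                 compose (toQPoly (monicFrom (c₀ ∷ + 0 ∷ []))) y ≈ 0#
  monic-root₀² {y} c₀ = ≈-trans (horner-form ⟦ c₀ ⟧ y)
    where
    horner-form : ∀ C₀ y → C₀ + y * ([ 0ℚ ] + y * (1# + y * 0#)) ≈ y ^ 2 + C₀
    horner-form = solve-∀ ring

  monic-root⁴ : ∀ {y} c₀ c₂ → y ^ 4 + ⟦ c₂ ⟧ * y ^ 2 + ⟦ c₀ ⟧ ≈ 0# →
                compose (toQPoly (monicFrom (c₀ ∷ + 0 ∷ c₂ ∷ + 0 ∷ []))) y ≈ 0#
  monic-root⁴ {y} c₀ c₂ = ≈-trans (horner-form ⟦ c₀ ⟧ ⟦ c₂ ⟧ y)
    where
    horner-form : ∀ C₀ C₂ y →
      C₀ + y * ([ 0ℚ ] + y * (C₂ + y * ([ 0ℚ ] + y * (1# + y * 0#)))) ≈ y ^ 4 + C₂ * y ^ 2 + C₀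
    horner-form = solve-∀ ring

  rescale² : ∀ P W m k → m ≈ W * (k * k) → P ^ 2 + - W ≈ 0# → (k * P) ^ 2 + - m ≈ 0#
  rescale² P W m k m≈ root = vanishes₁ (k * k) (begin
    (k * P) ^ 2 + - m              ≈⟨ +-cong (≈-refl {(k * P) ^ 2}) (-‿cong m≈) ⟩
    (k * P) ^ 2 + - (W * (k * k))  ≈⟨ identity k P W ⟩
    (k * k) * (P ^ 2 + - W)        ∎) root
    where
    identity : ∀ k P W → (k * P) ^ 2 + - (W * (k * k)) ≈ (k * k) * (P ^ 2 + - W)
    identity = solve-∀ ring

  rescale⁴ : ∀ P W c m k → m ≈ W * (k * k) → P ^ 4 + c * W * P ^ 2 + W ^ 3 ≈ 0# →
             (k * P) ^ 4 + m * c * (k * P) ^ 2 + m * m * W ≈ 0#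
  rescale⁴ P W c m k m≈ root = vanishes₁ ((k * k) ^ 2) (begin
    (k * P) ^ 4 + m * c * (k * P) ^ 2 + m * m * W
      ≈⟨ +-cong (+-cong (≈-refl {(k * P) ^ 4}) (*-cong (*-cong m≈ (≈-refl {c})) (≈-refl {(k * P) ^ 2})))
                (*-cong (*-cong m≈ m≈) (≈-refl {W})) ⟩
    (k * P) ^ 4 + W * (k * k) * c * (k * P) ^ 2 + W * (k * k) * (W * (k * k)) * W
      ≈⟨ identity k P W c ⟩
    (k * k) ^ 2 * (P ^ 4 + c * W * P ^ 2 + W ^ 3) ∎) root
    where
    identity : ∀ k P W c → (k * P) ^ 4 + W * (k * k) * c * (k * P) ^ 2 + W * (k * k) * (W * (k * k)) * W ≈
                           (k * k) ^ 2 * (P ^ 4 + c * W * P ^ 2 + W ^ 3)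
    identity = solve-∀ ring

  scaled-root² : ∀ P k w m → ⟦ m ⟧ ≈ ⟦ w ⟧ * ([ k ] * [ k ]) → P ^ 2 + - ⟦ w ⟧ ≈ 0# →
                 compose (toQPoly (monicFrom (ℤ.- m ∷ + 0 ∷ []))) ([ k ] * P) ≈ 0#
  scaled-root² P k w m m≈ root =
    monic-root₀² {[ k ] * P} (ℤ.- m)
      (≈-trans (+-cong (≈-refl {([ k ] * P) ^ 2}) (⟦⟧-homo‿- m))
               (rescale² P ⟦ w ⟧ ⟦ m ⟧ [ k ] m≈ root))

  scaled-root⁴ : ∀ P k w c m → ⟦ m ⟧ ≈ ⟦ w ⟧ * ([ k ] * [ k ]) →
                 P ^ 4 + ⟦ c ⟧ * ⟦ w ⟧ * P ^ 2 + ⟦ w ⟧ ^ 3 ≈ 0# →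
                 compose (toQPoly (monicFrom (m ℤ.* m ℤ.* w ∷ + 0 ∷ m ℤ.* c ∷ + 0 ∷ []))) ([ k ] * P) ≈ 0#
  scaled-root⁴ P k w c m m≈ root = monic-root⁴ {[ k ] * P} (m ℤ.* m ℤ.* w) (m ℤ.* c) (begin
    ([ k ] * P) ^ 4 + ⟦ m ℤ.* c ⟧ * ([ k ] * P) ^ 2 + ⟦ m ℤ.* m ℤ.* w ⟧
      ≈⟨ +-cong (+-cong (≈-refl {([ k ] * P) ^ 4}) (*-cong (⟦⟧-homo-* m c) (≈-refl {([ k ] * P) ^ 2})))
                (≈-trans (⟦⟧-homo-* (m ℤ.* m) w) (*-cong (⟦⟧-homo-* m m) (≈-refl {⟦ w ⟧}))) ⟩
    ([ k ] * P) ^ 4 + ⟦ m ⟧ * ⟦ c ⟧ * ([ k ] * P) ^ 2 + ⟦ m ⟧ * ⟦ m ⟧ * ⟦ w ⟧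
      ≈⟨ rescale⁴ P ⟦ w ⟧ ⟦ c ⟧ ⟦ m ⟧ [ k ] m≈ root ⟩
    0# ∎)

  -- The hypotheses say P = −W x/s and x³ P = s (c x² + s²); with v = s/x these give
  -- W = −v² (v² + c), P = v (v² + c), hence P⁴ + c W P² + W³ = 0.
  quartic-relation : ∀ x s P W c → s * P + W * x ≈ 0# → x ^ 3 * P + - (c * x ^ 2 * s) + - s ^ 3 ≈ 0# →
                     x ^ 4 * (P ^ 4 + c * W * P ^ 2 + W ^ 3) ≈ 0#
  quartic-relation x s P W c e₁ e₂ =
    vanishes₂ (x * P ^ 3) (c * x ^ 3 * P ^ 2 + x * ((s * P) ^ 2 + - (s * P * (W * x)) + (W * x) ^ 2))
      (identity x s P W c) e₂ e₁
    where
    identity : ∀ x s P W c → x ^ 4 * (P ^ 4 + c * W * P ^ 2 + W ^ 3) ≈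
      x * P ^ 3 * (x ^ 3 * P + - (c * x ^ 2 * s) + - s ^ 3) +
      (c * x ^ 3 * P ^ 2 + x * ((s * P) ^ 2 + - (s * P * (W * x)) + (W * x) ^ 2)) * (s * P + W * x)
    identity = solve-∀ ring

  module Palindromic {x A B : QPoly} (G≈0 : x ^ 8 + A * x ^ 6 + B * x ^ 4 + A * x ^ 2 + 1# ≈ 0#) where

    x⁻² : QPoly
    x⁻² = - (x ^ 6 + A * x ^ 4 + B * x ^ 2 + A)

    x²x⁻²≈1 : x ^ 2 * x⁻² + - 1# ≈ 0#
    x²x⁻²≈1 = vanishes₁ (- 1#) (identity x A B) G≈0
      where
      identity : ∀ x A B → x ^ 2 * - (x ^ 6 + A * x ^ 4 + B * x ^ 2 + A) + - 1# ≈
                           - 1# * (x ^ 8 + A * x ^ 6 + B * x ^ 4 + A * x ^ 2 + 1#)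
      identity = solve-∀ ring

    x⁴-cancel : ∀ {z} → x ^ 4 * z ≈ 0# → z ≈ 0#
    x⁴-cancel {z} x⁴z≈0 =
      vanishes₂ (- ((x ^ 2 * x⁻² + 1#) * z)) (x⁻² ^ 2) (identity x x⁻² z) x²x⁻²≈1 x⁴z≈0
      where
      identity : ∀ x y z → z ≈ - ((x ^ 2 * y + 1#) * z) * (x ^ 2 * y + - 1#) + y ^ 2 * (x ^ 4 * z)
      identity = solve-∀ ring

    x²+x⁻² : QPoly
    x²+x⁻² = x ^ 2 + x⁻²

    x²+x⁻²-root : x²+x⁻² ^ 2 + A * x²+x⁻² + (B + - 2#) ≈ 0#
    x²+x⁻²-root =
      x⁴-cancel (vanishes₂ 1# (2# * x ^ 4 + x ^ 2 * x⁻² + 1# + A * x ^ 2)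
                           (identity x x⁻² A B) G≈0 x²x⁻²≈1)
      where
      identity : ∀ x y A B → x ^ 4 * ((x ^ 2 + y) ^ 2 + A * (x ^ 2 + y) + (B + - 2#)) ≈
        1# * (x ^ 8 + A * x ^ 6 + B * x ^ 4 + A * x ^ 2 + 1#) +
        (2# * x ^ 4 + x ^ 2 * y + 1# + A * x ^ 2) * (x ^ 2 * y + - 1#)
      identity = solve-∀ ring

    W₁-root : ∀ {P W c} → P ≈ x * (x ^ 6 + (A + - 1#) * x ^ 4 + (B + - A + 1#) * x ^ 2 + (A + A + - B + - 1#)) →
              W ≈ B + 2# + - (2# * A) → c ≈ A + - 4# → P ^ 4 + c * W * P ^ 2 + W ^ 3 ≈ 0#
    W₁-root {P} {W} {c} P≈ W≈ c≈ = x⁴-cancel (quartic-relation x (x ^ 2 + 1#) P W c e₁ e₂)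
      where
      identity₁ : ∀ x A B →
        (x ^ 2 + 1#) * (x * (x ^ 6 + (A + - 1#) * x ^ 4 + (B + - A + 1#) * x ^ 2 + (A + A + - B + - 1#))) +
        (B + 2# + - (2# * A)) * x ≈ x * (x ^ 8 + A * x ^ 6 + B * x ^ 4 + A * x ^ 2 + 1#)
      identity₁ = solve-∀ ring
      identity₂ : ∀ x A B →
        x ^ 3 * (x * (x ^ 6 + (A + - 1#) * x ^ 4 + (B + - A + 1#) * x ^ 2 + (A + A + - B + - 1#))) +
        - ((A + - 4#) * x ^ 2 * (x ^ 2 + 1#)) + - (x ^ 2 + 1#) ^ 3 ≈
        (x ^ 2 + - 1#) * (x ^ 8 + A * x ^ 6 + B * x ^ 4 + A * x ^ 2 + 1#)
      identity₂ = solve-∀ ring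
      e₁ : (x ^ 2 + 1#) * P + W * x ≈ 0#
      e₁ = vanishes₁ x (≈-trans (+-cong (*-congˡ (x ^ 2 + 1#) P≈) (*-cong W≈ ≈-refl)) (identity₁ x A B)) G≈0
      e₂ : x ^ 3 * P + - (c * x ^ 2 * (x ^ 2 + 1#)) + - (x ^ 2 + 1#) ^ 3 ≈ 0#
      e₂ = vanishes₁ (x ^ 2 + - 1#)
             (≈-trans (+-cong (+-cong (*-congˡ (x ^ 3) P≈) (-‿cong (*-cong (*-cong c≈ ≈-refl) ≈-refl))) ≈-refl)
                      (identity₂ x A B)) G≈0

    W₂-root : ∀ {P W c} → P ≈ x * (x ^ 6 + (A + 1#) * x ^ 4 + (B + A + 1#) * x ^ 2 + (B + A + A + 1#)) →
              W ≈ B + 2# + 2# * A → c ≈ A + 4# → P ^ 4 + c * W * P ^ 2 + W ^ 3 ≈ 0#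
    W₂-root {P} {W} {c} P≈ W≈ c≈ = x⁴-cancel (quartic-relation x (x ^ 2 + - 1#) P W c e₁ e₂)
      where
      identity₁ : ∀ x A B →
        (x ^ 2 + - 1#) * (x * (x ^ 6 + (A + 1#) * x ^ 4 + (B + A + 1#) * x ^ 2 + (B + A + A + 1#))) +
        (B + 2# + 2# * A) * x ≈ x * (x ^ 8 + A * x ^ 6 + B * x ^ 4 + A * x ^ 2 + 1#)
      identity₁ = solve-∀ ring
      identity₂ : ∀ x A B →
        x ^ 3 * (x * (x ^ 6 + (A + 1#) * x ^ 4 + (B + A + 1#) * x ^ 2 + (B + A + A + 1#))) +
        - ((A + 4#) * x ^ 2 * (x ^ 2 + - 1#)) + - (x ^ 2 + - 1#) ^ 3 ≈
        (x ^ 2 + 1#) * (x ^ 8 + A * x ^ 6 + B * x ^ 4 + A * x ^ 2 + 1#)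
      identity₂ = solve-∀ ring
      e₁ : (x ^ 2 + - 1#) * P + W * x ≈ 0#
      e₁ = vanishes₁ x (≈-trans (+-cong (*-congˡ (x ^ 2 + - 1#) P≈) (*-cong W≈ ≈-refl)) (identity₁ x A B)) G≈0
      e₂ : x ^ 3 * P + - (c * x ^ 2 * (x ^ 2 + - 1#)) + - (x ^ 2 + - 1#) ^ 3 ≈ 0#
      e₂ = vanishes₁ (x ^ 2 + 1#)
             (≈-trans (+-cong (+-cong (*-congˡ (x ^ 3) P≈) (-‿cong (*-cong (*-cong c≈ ≈-refl) ≈-refl))) ≈-refl)
                      (identity₂ x A B)) G≈0

    W₃-root : ∀ {P W} → P ≈ 2# * x²+x⁻² + A → W ≈ A * A + - (4# * B) + 8# → P ^ 2 + - W ≈ 0#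
    W₃-root {P} {W} P≈ W≈ =
      vanishes₁ 4# (≈-trans (+-cong (^-congˡ 2 P≈) (-‿cong W≈)) (identity x²+x⁻² A B)) x²+x⁻²-root
      where
      identity : ∀ u A B → (2# * u + A) ^ 2 + - (A * A + - (4# * B) + 8#) ≈ 4# * (u ^ 2 + A * u + (B + - 2#))
      identity = solve-∀ ring

    halved-root₀₁ : ∀ {P s t} → P ≈ x²+x⁻² + 2# * s + 1# → A ≈ 4# * s → B ≈ 1# + 4# * t →
                    (½# * P) ^ 2 + - 1# * (½# * P) + (t + - (s * s)) ≈ 0#
    halved-root₀₁ {P} {s} {t} P≈ A≈ B≈ = vanishes₁ (½# * ½#) (begin
      (½# * P) ^ 2 + - 1# * (½# * P) + (t + - (s * s))
        ≈⟨ +-cong (+-cong (^-congˡ 2 (*-congˡ ½# P≈)) (*-congˡ (- 1#) (*-congˡ ½# P≈))) ≈-refl ⟩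
      (½# * (x²+x⁻² + 2# * s + 1#)) ^ 2 + - 1# * (½# * (x²+x⁻² + 2# * s + 1#)) + (t + - (s * s))
        ≈⟨ identity x²+x⁻² s t ⟩
      ½# * ½# * (x²+x⁻² ^ 2 + 4# * s * x²+x⁻² + (1# + 4# * t + - 2#))
        ≈⟨ *-congˡ (½# * ½#) (+-cong (+-cong (≈-refl {x²+x⁻² ^ 2}) (*-cong A≈ (≈-refl {x²+x⁻²})))
                                      (+-cong B≈ (≈-refl { - 2#}))) ⟨
      ½# * ½# * (x²+x⁻² ^ 2 + A * x²+x⁻² + (B + - 2#)) ∎) x²+x⁻²-root
      where
      identity : ∀ u s t → (½# * (u + 2# * s + 1#)) ^ 2 + - 1# * (½# * (u + 2# * s + 1#)) + (t + - (s * s)) ≈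
                           ½# * ½# * (u ^ 2 + 4# * s * u + (1# + 4# * t + - 2#))
      identity = solve-∀ ring

    halved-root₂₃ : ∀ {P s t} → P ≈ x²+x⁻² + 2# * s + 1# → A ≈ 2# + 4# * s → B ≈ 3# + 4# * t →
                    (½# * P) ^ 2 + (t + - s + - (s * s)) ≈ 0#
    halved-root₂₃ {P} {s} {t} P≈ A≈ B≈ = vanishes₁ (½# * ½#) (begin
      (½# * P) ^ 2 + (t + - s + - (s * s))
        ≈⟨ +-cong (^-congˡ 2 (*-congˡ ½# P≈)) ≈-refl ⟩
      (½# * (x²+x⁻² + 2# * s + 1#)) ^ 2 + (t + - s + - (s * s))
        ≈⟨ identity x²+x⁻² s t ⟩
      ½# * ½# * (x²+x⁻² ^ 2 + (2# + 4# * s) * x²+x⁻² + (3# + 4# * t + - 2#))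
        ≈⟨ *-congˡ (½# * ½#) (+-cong (+-cong (≈-refl {x²+x⁻² ^ 2}) (*-cong A≈ (≈-refl {x²+x⁻²})))
                                      (+-cong B≈ (≈-refl { - 2#}))) ⟨
      ½# * ½# * (x²+x⁻² ^ 2 + A * x²+x⁻² + (B + - 2#)) ∎) x²+x⁻²-root
      where
      identity : ∀ u s t → (½# * (u + 2# * s + 1#)) ^ 2 + (t + - s + - (s * s)) ≈
                           ½# * ½# * (u ^ 2 + (2# + 4# * s) * u + (3# + 4# * t + - 2#))
      identity = solve-∀ ring

  W₁-numerator≈ : ∀ α β →
    W₁-numerator α β ≈
    X * (X ^ 6 + ([ α ] + - 1#) * X ^ 4 + ([ β ] + - [ α ] + 1#) * X ^ 2 + ([ α ] + [ α ] + - [ β ] + - 1#))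
  W₁-numerator≈ α β = ≈-trans (≋⇒≈ (horner (W₁-numerator α β))) (identity X [ α ] [ β ])
    where
    identity : ∀ x A B →
      [ 0ℚ ] + x * ((A + A + - B + - 1#) + x * ([ 0ℚ ] + x * ((B + - A + 1#) + x * ([ 0ℚ ] + x *
        ((A + - 1#) + x * ([ 0ℚ ] + x * (1# + x * 0#))))))) ≈
      x * (x ^ 6 + (A + - 1#) * x ^ 4 + (B + - A + 1#) * x ^ 2 + (A + A + - B + - 1#))
    identity = solve-∀ ring

  W₂-numerator≈ : ∀ α β →
    W₂-numerator α β ≈
    X * (X ^ 6 + ([ α ] + 1#) * X ^ 4 + ([ β ] + [ α ] + 1#) * X ^ 2 + ([ β ] + [ α ] + [ α ] + 1#))
  W₂-numerator≈ α β = ≈-trans (≋⇒≈ (horner (W₂-numerator α β))) (identity X [ α ] [ β ])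
    where
    identity : ∀ x A B →
      [ 0ℚ ] + x * ((B + A + A + 1#) + x * ([ 0ℚ ] + x * ((B + A + 1#) + x * ([ 0ℚ ] + x *
        ((A + 1#) + x * ([ 0ℚ ] + x * (1# + x * 0#))))))) ≈
      x * (x ^ 6 + (A + 1#) * x ^ 4 + (B + A + 1#) * x ^ 2 + (B + A + A + 1#))
    identity = solve-∀ ring

  x²+x⁻²-coeffs≈ : ∀ α β →
    x²+x⁻²-coeffs α β ≈ X ^ 2 + - (X ^ 6 + [ α ] * X ^ 4 + [ β ] * X ^ 2 + [ α ])
  x²+x⁻²-coeffs≈ α β = ≈-trans (≋⇒≈ (horner (x²+x⁻²-coeffs α β))) (identity X [ α ] [ β ])
    where
    identity : ∀ x A B →
      - A + x * ([ 0ℚ ] + x * ((1# + - B) + x * ([ 0ℚ ] + x * (- A + x * ([ 0ℚ ] + x * (- 1# + x * 0#)))))) ≈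
      x ^ 2 + - (x ^ 6 + A * x ^ 4 + B * x ^ 2 + A)
    identity = solve-∀ ring

  𝒢≈ : ∀ a b → toQPoly (𝒢 a b) ≈ X ^ 8 + ⟦ a ⟧ * X ^ 6 + ⟦ b ⟧ * X ^ 4 + ⟦ a ⟧ * X ^ 2 + 1#
  𝒢≈ a b = ≈-trans (≋⇒≈ (horner (toQPoly (𝒢 a b)))) (identity X ⟦ a ⟧ ⟦ b ⟧)
    where
    identity : ∀ x A B →
      1# + x * ([ 0ℚ ] + x * (A + x * ([ 0ℚ ] + x * (B + x * ([ 0ℚ ] + x *
        (A + x * ([ 0ℚ ] + x * (1# + x * 0#)))))))) ≈
      x ^ 8 + A * x ^ 6 + B * x ^ 4 + A * x ^ 2 + 1#
    identity = solve-∀ ring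

-- Pairing coefficient lists with recurrent sequences

pairing : (ℕ → ℤ) → QPoly → ℚ
pairing c []      = 0ℚ
pairing c (a ∷ p) = a ℚ.* toℚ (c 0) ℚ.+ pairing (c ∘ suc) p

pairingℤ : (ℕ → ℤ) → ZPoly → ℤ
pairingℤ c []      = + 0
pairingℤ c (a ∷ r) = a ℤ.* c 0 ℤ.+ pairingℤ (c ∘ suc) r

pairing-toQPoly : ∀ c r → pairing c (toQPoly r) ≡ toℚ (pairingℤ c r)
pairing-toQPoly c []      = refl
pairing-toQPoly c (a ∷ r) = begin
  toℚ a ℚ.* toℚ (c 0) ℚ.+ pairing (c ∘ suc) (toQPoly r)
    ≡⟨ cong (toℚ a ℚ.* toℚ (c 0) ℚ.+_) (pairing-toQPoly (c ∘ suc) r) ⟩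
  toℚ a ℚ.* toℚ (c 0) ℚ.+ toℚ (pairingℤ (c ∘ suc) r)
    ≡⟨ cong (ℚ._+ toℚ (pairingℤ (c ∘ suc) r)) (toℚ-homo-* a (c 0)) ⟨
  toℚ (a ℤ.* c 0) ℚ.+ toℚ (pairingℤ (c ∘ suc) r)
    ≡⟨ toℚ-homo-+ (a ℤ.* c 0) (pairingℤ (c ∘ suc) r) ⟨
  toℚ (pairingℤ c (a ∷ r)) ∎
  where open ≡-Reasoning

pairing-cong : ∀ {c c′} → (∀ i → c i ≡ c′ i) → ∀ p → pairing c p ≡ pairing c′ p
pairing-cong e []      = refl
pairing-cong e (a ∷ p) = cong₂ (λ u v → a ℚ.* toℚ u ℚ.+ v) (e 0) (pairing-cong (e ∘ suc) p)

pairing-+ₚ : ∀ c p q → pairing c (p +ₚ q) ≡ pairing c p ℚ.+ pairing c q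
pairing-+ₚ c []      q       = sym (ℚP.+-identityˡ _)
pairing-+ₚ c (a ∷ p) []      = sym (ℚP.+-identityʳ _)
pairing-+ₚ c (a ∷ p) (b ∷ q) =
  trans (cong ((a ℚ.+ b) ℚ.* toℚ (c 0) ℚ.+_) (pairing-+ₚ (c ∘ suc) p q))
        (identity a b (toℚ (c 0)) (pairing (c ∘ suc) p) (pairing (c ∘ suc) q))
  where
  identity : ∀ a b C u v → (a ℚ.+ b) ℚ.* C ℚ.+ (u ℚ.+ v) ≡ (a ℚ.* C ℚ.+ u) ℚ.+ (b ℚ.* C ℚ.+ v)
  identity = solve-∀ ℚ-ring

pairing-·ₚ : ∀ c d p → pairing c (d ·ₚ p) ≡ d ℚ.* pairing c p
pairing-·ₚ c d []      = sym (ℚP.*-zeroʳ d)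
pairing-·ₚ c d (a ∷ p) =
  trans (cong (d ℚ.* a ℚ.* toℚ (c 0) ℚ.+_) (pairing-·ₚ (c ∘ suc) d p))
        (identity d a (toℚ (c 0)) (pairing (c ∘ suc) p))
  where
  identity : ∀ d a C u → d ℚ.* a ℚ.* C ℚ.+ d ℚ.* u ≡ d ℚ.* (a ℚ.* C ℚ.+ u)
  identity = solve-∀ ℚ-ring

pairing-neg : ∀ c p → pairing c (-ₚ p) ≡ ℚ.- pairing c p
pairing-neg c []      = refl
pairing-neg c (a ∷ p) =
  trans (cong (ℚ.- a ℚ.* toℚ (c 0) ℚ.+_) (pairing-neg (c ∘ suc) p))
        (identity a (toℚ (c 0)) (pairing (c ∘ suc) p))
  where
  identity : ∀ a C u → ℚ.- a ℚ.* C ℚ.+ ℚ.- u ≡ ℚ.- (a ℚ.* C ℚ.+ u)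
  identity = solve-∀ ℚ-ring

pairing-vanishing : ∀ c {p} → p ≋ [] → pairing c p ≡ 0ℚ
pairing-vanishing c {[]}    _              = refl
pairing-vanishing c {a ∷ p} (coeffwise e) =
  trans (cong₂ (λ u v → u ℚ.* toℚ (c 0) ℚ.+ v) (e 0)
               (pairing-vanishing (c ∘ suc) {p} (coeffwise (e ∘ suc))))
        (identity (toℚ (c 0)))
  where
  identity : ∀ C → 0ℚ ℚ.* C ℚ.+ 0ℚ ≡ 0ℚ
  identity = solve-∀ ℚ-ring

pairing-resp-≋ : ∀ c {p q} → p ≋ q → pairing c p ≡ pairing c q
pairing-resp-≋ c {[]}    {q}     e = sym (pairing-vanishing c (≋-sym e))
pairing-resp-≋ c {a ∷ p} {[]}    e = pairing-vanishing c e
pairing-resp-≋ c {a ∷ p} {b ∷ q} e@(coeffwise e₀) =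
  cong₂ (λ u v → u ℚ.* toℚ (c 0) ℚ.+ v) (e₀ 0) (pairing-resp-≋ (c ∘ suc) (∷-tail e))

-- c satisfies the linear recurrence with characteristic polynomial g.
record Annihilates (c : ℕ → ℤ) (g : QPoly) : Set where
  constructor annihilates
  field shifted : ∀ j → pairing (λ i → c (i ℕ.+ j)) g ≡ 0ℚ

pairing-multiple : ∀ {c g} → Annihilates c g → ∀ h → pairing c (h *ₚ g) ≡ 0ℚ
pairing-multiple         _                 []      = refl
pairing-multiple {c} {g} (annihilates ann) (a ∷ h) = begin
  pairing c ((a ·ₚ g) +ₚ (0ℚ ∷ (h *ₚ g)))
    ≡⟨ pairing-+ₚ c (a ·ₚ g) (0ℚ ∷ (h *ₚ g)) ⟩
  pairing c (a ·ₚ g) ℚ.+ pairing c (0ℚ ∷ (h *ₚ g))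
    ≡⟨ cong₂ ℚ._+_ (pairing-·ₚ c a g) (cong (0ℚ ℚ.* toℚ (c 0) ℚ.+_) tail≡0) ⟩
  a ℚ.* pairing c g ℚ.+ (0ℚ ℚ.* toℚ (c 0) ℚ.+ 0ℚ)
    ≡⟨ cong (λ u → a ℚ.* u ℚ.+ (0ℚ ℚ.* toℚ (c 0) ℚ.+ 0ℚ)) head≡0 ⟩
  a ℚ.* 0ℚ ℚ.+ (0ℚ ℚ.* toℚ (c 0) ℚ.+ 0ℚ)
    ≡⟨ identity a (toℚ (c 0)) ⟩
  0ℚ ∎
  where
  open ≡-Reasoning
  identity : ∀ a C → a ℚ.* 0ℚ ℚ.+ (0ℚ ℚ.* C ℚ.+ 0ℚ) ≡ 0ℚ
  identity = solve-∀ ℚ-ring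
  head≡0 : pairing c g ≡ 0ℚ
  head≡0 = trans (pairing-cong (λ i → cong c (sym (ℕP.+-identityʳ i))) g) (ann 0)
  tail≡0 : pairing (c ∘ suc) (h *ₚ g) ≡ 0ℚ
  tail≡0 = pairing-multiple
    (annihilates λ j → trans (pairing-cong (λ i → cong c (sym (ℕP.+-suc i j))) g) (ann (suc j))) h

∉ℤ[θ] : ∀ g p {c} → Annihilates c (toQPoly g) → (∀ z → pairing c p ≢ toℚ z) → ¬ InZθ g p
∉ℤ[θ] g p {c} ann fractional (r , h , e) = fractional (pairingℤ c r) (begin
  pairing c p
    ≡⟨ identity (pairing c p) R ⟩
  (pairing c p ℚ.+ ℚ.- R) ℚ.+ R
    ≡⟨ cong (λ u → (pairing c p ℚ.+ u) ℚ.+ R) (pairing-neg c (toQPoly r)) ⟨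
  (pairing c p ℚ.+ pairing c (-ₚ toQPoly r)) ℚ.+ R
    ≡⟨ cong (ℚ._+ R) (pairing-+ₚ c p (-ₚ toQPoly r)) ⟨
  pairing c (p -ₚ toQPoly r) ℚ.+ R
    ≡⟨ cong (ℚ._+ R) difference≡0 ⟩
  0ℚ ℚ.+ R
    ≡⟨ ℚP.+-identityˡ R ⟩
  R
    ≡⟨ pairing-toQPoly c r ⟩
  toℚ (pairingℤ c r) ∎)
  where
  open ≡-Reasoning
  R = pairing c (toQPoly r)
  identity : ∀ u v → u ≡ (u ℚ.+ ℚ.- v) ℚ.+ v
  identity = solve-∀ ℚ-ring
  difference≡0 : pairing c (p -ₚ toQPoly r) ≡ 0ℚ
  difference≡0 = trans (pairing-resp-≋ c {p -ₚ toQPoly r} {h *ₚ toQPoly g} (coeffwise e))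
                       (pairing-multiple {c} {toQPoly g} ann h)

indicator : ℕ → ℕ → ℤ
indicator t i = if i ℕ.≡ᵇ t then + 1 else + 0

pairing-indicator : ∀ t p → pairing (indicator t) p ≡ coeff p t
pairing-indicator t       []      = refl
pairing-indicator zero    (a ∷ p) = trans (cong (a ℚ.* 1ℚ ℚ.+_) (pairing-zero p)) (identity a)
  where
  pairing-zero : ∀ p → pairing (λ _ → + 0) p ≡ 0ℚ
  pairing-zero []      = refl
  pairing-zero (a ∷ p) = trans (cong (a ℚ.* 0ℚ ℚ.+_) (pairing-zero p)) (absorb a)
    where
    absorb : ∀ a → a ℚ.* 0ℚ ℚ.+ 0ℚ ≡ 0ℚ
    absorb = solve-∀ ℚ-ring
  identity : ∀ a → a ℚ.* 1ℚ ℚ.+ 0ℚ ≡ a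
  identity = solve-∀ ℚ-ring
pairing-indicator (suc t) (a ∷ p) =
  trans (cong (a ℚ.* 0ℚ ℚ.+_) (pairing-indicator t p)) (identity a (coeff p t))
  where
  identity : ∀ a u → a ℚ.* 0ℚ ℚ.+ u ≡ u
  identity = solve-∀ ℚ-ring

-- Pairing with coordinate-seq a b t reads off the θᵗ-coordinate of an element of ℚ(θ)
-- in the basis 1, θ, …, θ⁷: its first eight terms are the t-th unit vector and it
-- satisfies the recurrence of 𝒢.
coordinate-seq : ℤ → ℤ → ℕ → ℕ → ℤ
coordinate-seq a b t (suc (suc (suc (suc (suc (suc (suc (suc n)))))))) =
  ℤ.- (coordinate-seq a b t n
       ℤ.+ a ℤ.* coordinate-seq a b t (suc (suc n))
       ℤ.+ b ℤ.* coordinate-seq a b t (suc (suc (suc (suc n))))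
       ℤ.+ a ℤ.* coordinate-seq a b t (suc (suc (suc (suc (suc (suc n)))))))
coordinate-seq a b t n = indicator t n

coordinate-seq-annihilates : ∀ a b t → Annihilates (coordinate-seq a b t) (toQPoly (𝒢 a b))
coordinate-seq-annihilates a b t = annihilates shifted
  where
  toℚ-recurrence : ∀ x y z w → toℚ (ℤ.- (x ℤ.+ a ℤ.* y ℤ.+ b ℤ.* z ℤ.+ a ℤ.* w)) ≡
                   ℚ.- (toℚ x ℚ.+ toℚ a ℚ.* toℚ y ℚ.+ toℚ b ℚ.* toℚ z ℚ.+ toℚ a ℚ.* toℚ w)
  toℚ-recurrence x y z w = begin
    toℚ (ℤ.- (x ℤ.+ a ℤ.* y ℤ.+ b ℤ.* z ℤ.+ a ℤ.* w))
      ≡⟨ toℚ-homo‿- (x ℤ.+ a ℤ.* y ℤ.+ b ℤ.* z ℤ.+ a ℤ.* w) ⟩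
    ℚ.- toℚ (x ℤ.+ a ℤ.* y ℤ.+ b ℤ.* z ℤ.+ a ℤ.* w)
      ≡⟨ cong ℚ.-_ (toℚ-homo-+ (x ℤ.+ a ℤ.* y ℤ.+ b ℤ.* z) (a ℤ.* w)) ⟩
    ℚ.- (toℚ (x ℤ.+ a ℤ.* y ℤ.+ b ℤ.* z) ℚ.+ toℚ (a ℤ.* w))
      ≡⟨ cong ℚ.-_ (cong₂ ℚ._+_ (toℚ-homo-+ (x ℤ.+ a ℤ.* y) (b ℤ.* z)) (toℚ-homo-* a w)) ⟩
    ℚ.- (toℚ (x ℤ.+ a ℤ.* y) ℚ.+ toℚ (b ℤ.* z) ℚ.+ toℚ a ℚ.* toℚ w)
      ≡⟨ cong (λ u → ℚ.- (u ℚ.+ toℚ a ℚ.* toℚ w))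
              (cong₂ ℚ._+_ (toℚ-homo-+ x (a ℤ.* y)) (toℚ-homo-* b z)) ⟩
    ℚ.- (toℚ x ℚ.+ toℚ (a ℤ.* y) ℚ.+ toℚ b ℚ.* toℚ z ℚ.+ toℚ a ℚ.* toℚ w)
      ≡⟨ cong (λ u → ℚ.- (toℚ x ℚ.+ u ℚ.+ toℚ b ℚ.* toℚ z ℚ.+ toℚ a ℚ.* toℚ w))
              (toℚ-homo-* a y) ⟩
    ℚ.- (toℚ x ℚ.+ toℚ a ℚ.* toℚ y ℚ.+ toℚ b ℚ.* toℚ z ℚ.+ toℚ a ℚ.* toℚ w) ∎
    where open ≡-Reasoning
  recurrence-sum : ∀ A B c₀ c₁ c₂ c₃ c₄ c₅ c₆ c₇ →
    1ℚ ℚ.* c₀ ℚ.+ (0ℚ ℚ.* c₁ ℚ.+ (A ℚ.* c₂ ℚ.+ (0ℚ ℚ.* c₃ ℚ.+ (B ℚ.* c₄ ℚ.+ (0ℚ ℚ.* c₅ ℚ.+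
      (A ℚ.* c₆ ℚ.+ (0ℚ ℚ.* c₇ ℚ.+
      (1ℚ ℚ.* ℚ.- (c₀ ℚ.+ A ℚ.* c₂ ℚ.+ B ℚ.* c₄ ℚ.+ A ℚ.* c₆) ℚ.+ 0ℚ)))))))) ≡ 0ℚ
  recurrence-sum = solve-∀ ℚ-ring
  recurrence : ∀ A B c₀ c₁ c₂ c₃ c₄ c₅ c₆ c₇ c₈ →
    c₈ ≡ ℚ.- (c₀ ℚ.+ A ℚ.* c₂ ℚ.+ B ℚ.* c₄ ℚ.+ A ℚ.* c₆) →
    1ℚ ℚ.* c₀ ℚ.+ (0ℚ ℚ.* c₁ ℚ.+ (A ℚ.* c₂ ℚ.+ (0ℚ ℚ.* c₃ ℚ.+ (B ℚ.* c₄ ℚ.+ (0ℚ ℚ.* c₅ ℚ.+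
      (A ℚ.* c₆ ℚ.+ (0ℚ ℚ.* c₇ ℚ.+ (1ℚ ℚ.* c₈ ℚ.+ 0ℚ)))))))) ≡ 0ℚ
  recurrence A B c₀ c₁ c₂ c₃ c₄ c₅ c₆ c₇ _ refl = recurrence-sum A B c₀ c₁ c₂ c₃ c₄ c₅ c₆ c₇
  shifted : ∀ j → pairing (λ i → coordinate-seq a b t (i ℕ.+ j)) (toQPoly (𝒢 a b)) ≡ 0ℚ
  shifted j = recurrence (toℚ a) (toℚ b) (C 0) (C 1) (C 2) (C 3) (C 4) (C 5) (C 6) (C 7) (C 8)
                (toℚ-recurrence (d 0) (d 2) (d 4) (d 6))
    where
    d : ℕ → ℤ
    d i = coordinate-seq a b t (i ℕ.+ j)
    C : ℕ → ℚ
    C = toℚ ∘ d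

[1+_]ℚ : ℕ → ℚ
[1+ q′ ]ℚ = mkℚ (+ suc q′) 0 (Coprimality.sym (Coprimality.1-coprimeTo (suc q′)))

1/[1+_] : ℕ → ℚ
1/[1+ q′ ] = ℚ.1/ [1+ q′ ]ℚ

*-1/[1+_] : ∀ q′ → toℚ (+ suc q′) ℚ.* 1/[1+ q′ ] ≡ 1ℚ
*-1/[1+ q′ ] = trans (cong (ℚ._* 1/[1+ q′ ]) (toℚ≡mkℚ (+ suc q′))) (ℚP.*-inverseʳ [1+ q′ ]ℚ)

1/[1+_]-integral : ∀ q′ m z → 1/[1+ q′ ] ℚ.* toℚ m ≡ toℚ z → m ≡ + suc q′ ℤ.* z
1/[1+ q′ ]-integral m z e = toℚ-injective (begin
  toℚ m                                      ≡⟨ ℚP.*-identityˡ (toℚ m) ⟨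
  1ℚ ℚ.* toℚ m                               ≡⟨ cong (ℚ._* toℚ m) (*-1/[1+ q′ ]) ⟨
  toℚ (+ suc q′) ℚ.* 1/[1+ q′ ] ℚ.* toℚ m    ≡⟨ ℚP.*-assoc (toℚ (+ suc q′)) 1/[1+ q′ ] (toℚ m) ⟩
  toℚ (+ suc q′) ℚ.* (1/[1+ q′ ] ℚ.* toℚ m)  ≡⟨ cong (toℚ (+ suc q′) ℚ.*_) e ⟩
  toℚ (+ suc q′) ℚ.* toℚ z                   ≡⟨ toℚ-homo-* (+ suc q′) z ⟨
  toℚ (+ suc q′ ℤ.* z)                       ∎)
  where open ≡-Reasoning

not-integral : ∀ q′ m .{{_ : ℕ.NonZero ℤ.∣ m ∣}} → ℤ.∣ m ∣ ℕ.< suc q′ →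
               ∀ z → 1/[1+ q′ ] ℚ.* toℚ m ≢ toℚ z
not-integral q′ m small z e = ℕP.<⇒≱ small (ℕ∣.∣⇒≤ (divides ℤ.∣ z ∣ (begin
  ℤ.∣ m ∣               ≡⟨ cong ℤ.∣_∣ (1/[1+ q′ ]-integral m z e) ⟩
  ℤ.∣ + suc q′ ℤ.* z ∣  ≡⟨ ℤP.abs-* (+ suc q′) z ⟩
  suc q′ ℕ.* ℤ.∣ z ∣    ≡⟨ ℕP.*-comm (suc q′) ℤ.∣ z ∣ ⟩
  ℤ.∣ z ∣ ℕ.* suc q′    ∎)))
  where open ≡-Reasoning

square-factor : ∀ q w → SqDivides q w → Σ ℤ λ m → w ≡ m ℤ.* + (q ℕ.* q)
square-factor q (+ n)    (divides m e) = + m , trans (cong +_ e) (ℤP.pos-* m (q ℕ.* q))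
square-factor q -[1+ n ] (divides m e) =
  ℤ.- + m , trans (cong (ℤ.-_ ∘ +_) e)
                  (trans (cong ℤ.-_ (ℤP.pos-* m (q ℕ.* q))) (ℤP.neg-distribˡ-* (+ m) (+ (q ℕ.* q))))

square-cofactor : ∀ q′ w m → w ≡ m ℤ.* + (suc q′ ℕ.* suc q′) →
                  toℚ m ≡ toℚ w ℚ.* (1/[1+ q′ ] ℚ.* 1/[1+ q′ ])
square-cofactor q′ w m refl = sym (begin
  toℚ (m ℤ.* + (suc q′ ℕ.* suc q′)) ℚ.* (k ℚ.* k)
    ≡⟨ cong (ℚ._* (k ℚ.* k)) (toℚ-homo-* m (+ (suc q′ ℕ.* suc q′))) ⟩
  toℚ m ℚ.* toℚ (+ (suc q′ ℕ.* suc q′)) ℚ.* (k ℚ.* k)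
    ≡⟨ cong (λ u → toℚ m ℚ.* u ℚ.* (k ℚ.* k))
            (trans (cong toℚ (ℤP.pos-* (suc q′) (suc q′))) (toℚ-homo-* (+ suc q′) (+ suc q′))) ⟩
  toℚ m ℚ.* (Q ℚ.* Q) ℚ.* (k ℚ.* k)    ≡⟨ regroup (toℚ m) Q k ⟩
  toℚ m ℚ.* ((Q ℚ.* k) ℚ.* (Q ℚ.* k))  ≡⟨ cong (λ u → toℚ m ℚ.* (u ℚ.* u)) (*-1/[1+ q′ ]) ⟩
  toℚ m ℚ.* (1ℚ ℚ.* 1ℚ)                ≡⟨ unit (toℚ m) ⟩
  toℚ m                                ∎)
  where
  open ≡-Reasoning
  k = 1/[1+ q′ ]
  Q = toℚ (+ suc q′)
  regroup : ∀ m Q k → m ℚ.* (Q ℚ.* Q) ℚ.* (k ℚ.* k) ≡ m ℚ.* ((Q ℚ.* k) ℚ.* (Q ℚ.* k))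
  regroup = solve-∀ ℚ-ring
  unit : ∀ m → m ℚ.* (1ℚ ℚ.* 1ℚ) ≡ m
  unit = solve-∀ ℚ-ring

mod-4 : ∀ x r → x %ℕ 4 ≡ r → x ≡ + r ℤ.+ + 4 ℤ.* (x /ℕ 4)
mod-4 x r e = trans (a≡a%ℕn+[a/ℕn]*n x 4) (cong₂ ℤ._+_ (cong +_ e) (ℤP.*-comm (x /ℕ 4) (+ 4)))

module Obstructions (a b : ℤ) where
  open Quotient (toQPoly (𝒢 a b))
  open Palindromic {X} {⟦ a ⟧} {⟦ b ⟧} (≈-trans (≈-sym (𝒢≈ a b)) f≈0)

  obstruction : ∀ cs p → compose (toQPoly (monicFrom cs)) p ≈ 0# → ¬ InZθ (𝒢 a b) p →
                ¬ Monogenic (𝒢 a b)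
  obstruction cs p root ∉ (_ , integrally-closed) = ∉ (integrally-closed p (cs , ≈0⇒∣ₚ root))

  -- Applied with pairing-indicator t p, which has the required type by computation when p
  -- has degree < 8, because coordinate-seq a b t starts with the eight terms of indicator t.
  fractional-coordinate : ∀ t p q′ m .{{_ : ℕ.NonZero ℤ.∣ m ∣}} → ℤ.∣ m ∣ ℕ.< suc q′ →
                          pairing (coordinate-seq a b t) p ≡ 1/[1+ q′ ] ℚ.* toℚ m →
                          ¬ InZθ (𝒢 a b) p
  fractional-coordinate t p q′ m small value =
    ∉ℤ[θ] (𝒢 a b) p (coordinate-seq-annihilates a b t)
      λ z e → not-integral q′ m small z (trans (sym value) e)

  ⟦r+4x⟧≈ : ∀ r x → ⟦ + r ℤ.+ + 4 ℤ.* x ⟧ ≈ ⟦ + r ⟧ + 4# * ⟦ x ⟧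
  ⟦r+4x⟧≈ r x = ≈-trans (⟦⟧-homo-+ (+ r) (+ 4 ℤ.* x)) (+-cong (≈-refl {⟦ + r ⟧}) (⟦⟧-homo-* (+ 4) x))

  square-cofactor≈ : ∀ q′ w → SqDivides (suc q′) w →
                     Σ ℤ λ m → ⟦ m ⟧ ≈ ⟦ w ⟧ * ([ 1/[1+ q′ ] ] * [ 1/[1+ q′ ] ])
  square-cofactor≈ q′ w q²∣w with square-factor (suc q′) w q²∣w
  ... | m , w≡ = m , ≈-trans (≡⇒≈ (cong [_] (square-cofactor q′ w m w≡)))
                       (≈-trans (≋⇒≈ ([]-homo-* (toℚ w) (1/[1+ q′ ] ℚ.* 1/[1+ q′ ])))
                                (*-congˡ ⟦ w ⟧ (≋⇒≈ ([]-homo-* 1/[1+ q′ ] 1/[1+ q′ ]))))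

  W₁-obstruction : ∀ {q} → 2 ≤ q → SqDivides q (W₁ a b) → ¬ Monogenic (𝒢 a b)
  W₁-obstruction {suc q′} (s≤s 1≤q′) q²∣W₁ =
    obstruction cs p root
      (fractional-coordinate 7 p q′ (+ 1) (s≤s 1≤q′) (pairing-indicator 7 p))
    where
    k = 1/[1+ q′ ]
    m = proj₁ (square-cofactor≈ q′ (W₁ a b) q²∣W₁)
    P = W₁-numerator (toℚ a) (toℚ b)
    p = [ k ] * P
    cs = m ℤ.* m ℤ.* W₁ a b ∷ + 0 ∷ m ℤ.* (a ℤ.- + 4) ∷ + 0 ∷ []
    W≈ : ⟦ W₁ a b ⟧ ≈ ⟦ b ⟧ + 2# + - (2# * ⟦ a ⟧)
    W≈ = ≈-trans (⟦⟧-homo-+ (b ℤ.+ + 2) (ℤ.- (+ 2 ℤ.* a)))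
           (+-cong (⟦⟧-homo-+ b (+ 2)) (≈-trans (⟦⟧-homo‿- (+ 2 ℤ.* a)) (-‿cong (⟦⟧-homo-* (+ 2) a))))
    root : compose (toQPoly (monicFrom cs)) p ≈ 0#
    root = scaled-root⁴ P k (W₁ a b) (a ℤ.- + 4) m (proj₂ (square-cofactor≈ q′ (W₁ a b) q²∣W₁))
             (W₁-root (W₁-numerator≈ (toℚ a) (toℚ b)) W≈ (⟦⟧-homo-+ a (ℤ.- + 4)))

  W₂-obstruction : ∀ {q} → 2 ≤ q → SqDivides q (W₂ a b) → ¬ Monogenic (𝒢 a b)
  W₂-obstruction {suc q′} (s≤s 1≤q′) q²∣W₂ =
    obstruction cs p root
      (fractional-coordinate 7 p q′ (+ 1) (s≤s 1≤q′) (pairing-indicator 7 p))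
    where
    k = 1/[1+ q′ ]
    m = proj₁ (square-cofactor≈ q′ (W₂ a b) q²∣W₂)
    P = W₂-numerator (toℚ a) (toℚ b)
    p = [ k ] * P
    cs = m ℤ.* m ℤ.* W₂ a b ∷ + 0 ∷ m ℤ.* (a ℤ.+ + 4) ∷ + 0 ∷ []
    W≈ : ⟦ W₂ a b ⟧ ≈ ⟦ b ⟧ + 2# + 2# * ⟦ a ⟧
    W≈ = ≈-trans (⟦⟧-homo-+ (b ℤ.+ + 2) (+ 2 ℤ.* a))
           (+-cong (⟦⟧-homo-+ b (+ 2)) (⟦⟧-homo-* (+ 2) a))
    root : compose (toQPoly (monicFrom cs)) p ≈ 0#
    root = scaled-root⁴ P k (W₂ a b) (a ℤ.+ + 4) m (proj₂ (square-cofactor≈ q′ (W₂ a b) q²∣W₂))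
             (W₂-root (W₂-numerator≈ (toℚ a) (toℚ b)) W≈ (⟦⟧-homo-+ a (+ 4)))

  W₃-obstruction : ∀ {q} → 3 ≤ q → SqDivides q (W₃ a b) → ¬ Monogenic (𝒢 a b)
  W₃-obstruction {suc q′} (s≤s 2≤q′) q²∣W₃ =
    obstruction cs p root
      (fractional-coordinate 6 p q′ -[1+ 1 ] (s≤s 2≤q′) (pairing-indicator 6 p))
    where
    k = 1/[1+ q′ ]
    m = proj₁ (square-cofactor≈ q′ (W₃ a b) q²∣W₃)
    P = 2# * x²+x⁻²-coeffs (toℚ a) (toℚ b) + ⟦ a ⟧
    p = [ k ] * P
    cs = ℤ.- m ∷ + 0 ∷ []
    W≈ : ⟦ W₃ a b ⟧ ≈ ⟦ a ⟧ * ⟦ a ⟧ + - (4# * ⟦ b ⟧) + 8#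
    W≈ = ≈-trans (⟦⟧-homo-+ (a ℤ.* a ℤ.- + 4 ℤ.* b) (+ 8))
           (+-cong (≈-trans (⟦⟧-homo-+ (a ℤ.* a) (ℤ.- (+ 4 ℤ.* b)))
                            (+-cong (⟦⟧-homo-* a a)
                                    (≈-trans (⟦⟧-homo‿- (+ 4 ℤ.* b)) (-‿cong (⟦⟧-homo-* (+ 4) b)))))
                   (≈-refl {8#}))
    P≈ : P ≈ 2# * x²+x⁻² + ⟦ a ⟧
    P≈ = +-cong (*-congˡ 2# (x²+x⁻²-coeffs≈ (toℚ a) (toℚ b))) (≈-refl {⟦ a ⟧})
    root : compose (toQPoly (monicFrom cs)) p ≈ 0#
    root = scaled-root² P k (W₃ a b) m (proj₂ (square-cofactor≈ q′ (W₃ a b) q²∣W₃))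
             (W₃-root P≈ W≈)

  obstruction₀₁ : ∀ s t → a ≡ + 4 ℤ.* s → b ≡ + 1 ℤ.+ + 4 ℤ.* t → ¬ Monogenic (𝒢 a b)
  obstruction₀₁ s t a≡ b≡ =
    obstruction cs p root
      (fractional-coordinate 6 p 1 -[1+ 0 ] (s≤s (s≤s z≤n)) (pairing-indicator 6 p))
    where
    P = x²+x⁻²-coeffs (toℚ a) (toℚ b) + 2# * ⟦ s ⟧ + 1#
    p = ½# * P
    cs = t ℤ.- s ℤ.* s ∷ ℤ.- + 1 ∷ []
    P≈ : P ≈ x²+x⁻² + 2# * ⟦ s ⟧ + 1#
    P≈ = +-cong (+-cong (x²+x⁻²-coeffs≈ (toℚ a) (toℚ b)) (≈-refl {2# * ⟦ s ⟧})) (≈-refl {1#})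
    A≈ : ⟦ a ⟧ ≈ 4# * ⟦ s ⟧
    A≈ = ≈-trans (≡⇒≈ (cong ⟦_⟧ a≡)) (⟦⟧-homo-* (+ 4) s)
    B≈ : ⟦ b ⟧ ≈ 1# + 4# * ⟦ t ⟧
    B≈ = ≈-trans (≡⇒≈ (cong ⟦_⟧ b≡)) (⟦r+4x⟧≈ 1 t)
    c₀≈ : ⟦ t ℤ.- s ℤ.* s ⟧ ≈ ⟦ t ⟧ + - (⟦ s ⟧ * ⟦ s ⟧)
    c₀≈ = ≈-trans (⟦⟧-homo-+ t (ℤ.- (s ℤ.* s)))
            (+-cong (≈-refl {⟦ t ⟧}) (≈-trans (⟦⟧-homo‿- (s ℤ.* s)) (-‿cong (⟦⟧-homo-* s s))))
    root : compose (toQPoly (monicFrom cs)) p ≈ 0#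
    root = monic-root² {p} (t ℤ.- s ℤ.* s) (ℤ.- + 1)
             (≈-trans (+-cong (≈-refl {p ^ 2 + - 1# * p}) c₀≈)
                      (halved-root₀₁ {P} {⟦ s ⟧} {⟦ t ⟧} P≈ A≈ B≈))

  obstruction₂₃ : ∀ s t → a ≡ + 2 ℤ.+ + 4 ℤ.* s → b ≡ + 3 ℤ.+ + 4 ℤ.* t → ¬ Monogenic (𝒢 a b)
  obstruction₂₃ s t a≡ b≡ =
    obstruction cs p root
      (fractional-coordinate 6 p 1 -[1+ 0 ] (s≤s (s≤s z≤n)) (pairing-indicator 6 p))
    where
    P = x²+x⁻²-coeffs (toℚ a) (toℚ b) + 2# * ⟦ s ⟧ + 1#
    p = ½# * P
    cs = t ℤ.- s ℤ.- s ℤ.* s ∷ + 0 ∷ []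
    P≈ : P ≈ x²+x⁻² + 2# * ⟦ s ⟧ + 1#
    P≈ = +-cong (+-cong (x²+x⁻²-coeffs≈ (toℚ a) (toℚ b)) (≈-refl {2# * ⟦ s ⟧})) (≈-refl {1#})
    A≈ : ⟦ a ⟧ ≈ 2# + 4# * ⟦ s ⟧
    A≈ = ≈-trans (≡⇒≈ (cong ⟦_⟧ a≡)) (⟦r+4x⟧≈ 2 s)
    B≈ : ⟦ b ⟧ ≈ 3# + 4# * ⟦ t ⟧
    B≈ = ≈-trans (≡⇒≈ (cong ⟦_⟧ b≡)) (⟦r+4x⟧≈ 3 t)
    c₀≈ : ⟦ t ℤ.- s ℤ.- s ℤ.* s ⟧ ≈ ⟦ t ⟧ + - ⟦ s ⟧ + - (⟦ s ⟧ * ⟦ s ⟧)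
    c₀≈ = ≈-trans (⟦⟧-homo-+ (t ℤ.- s) (ℤ.- (s ℤ.* s)))
            (+-cong (≈-trans (⟦⟧-homo-+ t (ℤ.- s)) (+-cong (≈-refl {⟦ t ⟧}) (⟦⟧-homo‿- s)))
                    (≈-trans (⟦⟧-homo‿- (s ℤ.* s)) (-‿cong (⟦⟧-homo-* s s))))
    root : compose (toQPoly (monicFrom cs)) p ≈ 0#
    root = monic-root₀² {p} (t ℤ.- s ℤ.- s ℤ.* s)
             (≈-trans (+-cong (≈-refl {p ^ 2}) c₀≈) (halved-root₂₃ {P} {⟦ s ⟧} {⟦ t ⟧} P≈ A≈ B≈))

lemma3p2 : (a b : ℤ) → a ≢ + 0 →
    ((Σ ℕ λ q → Prime q × (SqDivides q (W₁ a b) ⊎ SqDivides q (W₂ a b))) →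
      ¬ Monogenic (𝒢 a b))
    ×
    (Squarefree (W₁ a b) → Squarefree (W₂ a b) →
      (Σ ℕ λ q → Prime q × 3 ≤ q × SqDivides q (W₃ a b)) →
      ¬ Monogenic (𝒢 a b))
    ×
    (Squarefree (W₁ a b) → Squarefree (W₂ a b) →
      (∀ q → Prime q → q ≢ 2 → ¬ SqDivides q (W₃ a b)) →
      ((a %ℕ 4 ≡ 0 × b %ℕ 4 ≡ 1) ⊎ (a %ℕ 4 ≡ 2 × b %ℕ 4 ≡ 3)) →
      ¬ Monogenic (𝒢 a b))
lemma3p2 a b _ = W₁-or-W₂ , (λ _ _ → W₃-part) , (λ _ _ _ → residues)
  where
  open Obstructions a b
  2≤ : ∀ {q} → Prime q → 2 ≤ q
  2≤ {q} q-prime = nonTrivial⇒n>1 q {{prime⇒nonTrivial q-prime}}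
  W₁-or-W₂ : (Σ ℕ λ q → Prime q × (SqDivides q (W₁ a b) ⊎ SqDivides q (W₂ a b))) →
             ¬ Monogenic (𝒢 a b)
  W₁-or-W₂ (q , q-prime , inj₁ q²∣W₁) = W₁-obstruction (2≤ q-prime) q²∣W₁
  W₁-or-W₂ (q , q-prime , inj₂ q²∣W₂) = W₂-obstruction (2≤ q-prime) q²∣W₂
  W₃-part : (Σ ℕ λ q → Prime q × 3 ≤ q × SqDivides q (W₃ a b)) → ¬ Monogenic (𝒢 a b)
  W₃-part (q , _ , 3≤q , q²∣W₃) = W₃-obstruction 3≤q q²∣W₃
  residues : ((a %ℕ 4 ≡ 0 × b %ℕ 4 ≡ 1) ⊎ (a %ℕ 4 ≡ 2 × b %ℕ 4 ≡ 3)) → ¬ Monogenic (𝒢 a b)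
  residues (inj₁ (a≡0 , b≡1)) =
    obstruction₀₁ (a /ℕ 4) (b /ℕ 4) (trans (mod-4 a 0 a≡0) (ℤP.+-identityˡ _)) (mod-4 b 1 b≡1)
  residues (inj₂ (a≡2 , b≡3)) = obstruction₂₃ (a /ℕ 4) (b /ℕ 4) (mod-4 a 2 a≡2) (mod-4 b 3 b≡3)
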